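{- In $\mathsf{2CH}$, for every agent $a$, every agent formula $\varphi$ of sort $a$ and every world formula $\Phi$, the following are derivable: (1) $\vdash_e\langle a\rangle\varphi\to[a]\varphi$; (2) $\vdash_a\Box_a\Phi\to\Box_a\langle a\rangle\Box_a\Phi$; (3) $\vdash_e\langle a\rangle\Box_a\Phi\to\Phi$; (4) $\vdash_e\Phi\to[a]\Diamond_a\Phi$; (5) $\vdash_a\varphi\to\Box_a\langle a\rangle\varphi$; (6) $\vdash_a\Box_a\Phi\to\Diamond_a\Phi$.
   Context: Syntax. Fix a finite set $\mathcal{A}$ of agents, sets $AP_a$ ($a\in\mathcal A$) and $AP_e$ of atomic propositions. Agent formulas of sort $a$: $\varphi ::= p_a \mid \neg\varphi \mid \varphi\wedge\psi \mid \Diamond_a\Phi$ ($p_a\in AP_a$, $\Phi$ a world formula). World formulas: $\Phi ::= p_e \mid \neg\Phi \mid \Phi\wedge\Psi \mid \langle a\rangle\varphi$ ($p_e\in AP_e$, $\varphi$ of sort $a$). Abbreviations: usual $\top,\bot,\vee,\to$; $\Box_a\Phi:=\neg\Diamond_a\neg\Phi$; $[a]\varphi:=\neg\langle a\rangle\neg\varphi$. Proof system. $\vdash_a$, $\vdash_e$ are the least relations containing all propositional tautology instances at each sort, closed under modus ponens at each sort, and under: from $\vdash_e\Phi$ infer $\vdash_a\Box_a\Phi$; from $\vdash_a\varphi$ infer $\vdash_e[a]\varphi$; from $\vdash_e\Phi\to\Psi$ infer $\vdash_a\Diamond_a\Phi\to\Diamond_a\Psi$ and $\vdash_a\Box_a\Phi\to\Box_a\Psi$;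 from $\vdash_a\varphi\to\psi$ infer $\vdash_e\langle a\rangle\varphi\to\langle a\rangle\psi$ and $\vdash_e[a]\varphi\to[a]\psi$; $\vdash_e\Phi\to[a]\psi$ iff $\vdash_a\Diamond_a\Phi\to\psi$; $\vdash_a\varphi\to\Box_a\Psi$ iff $\vdash_e\langle a\rangle\varphi\to\Psi$; axioms $\vdash_a\varphi\to\Diamond_a\langle a\rangle\varphi$, $\vdash_a\Diamond_a\langle a\rangle\varphi\to\varphi$, $\vdash_e\bigvee_{a\in\mathcal A}\langle a\rangle\top$. -}

module Defs where

open import Data.Nat using (ℕ)
open import Data.Fin using (Fin)
open import Data.Bool using (Bool; true; false; not; _∧_)
open import Data.List using (List; []; _∷_; allFin)
open import Relation.Binary.PropositionalEquality using (_≡_)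

data Prop : Set where
  var : ℕ → Prop
  bot : Prop
  neg : Prop → Prop
  and : Prop → Prop → Prop

evalP : (ℕ → Bool) → Prop → Bool
evalP v (var k) = v k
evalP v bot = false
evalP v (neg p) = not (evalP v p)
evalP v (and p q) = evalP v p ∧ evalP v q

Tautology : Prop → Set
Tautology p = (v : ℕ → Bool) → evalP v p ≡ true

instP : {F : Set} → F → (F → F) → (F → F → F) → (ℕ → F) → Prop → F
instP b ng an σ (var k) = σ k
instP b ng an σ bot = b
instP b ng an σ (neg p) = ng (instP b ng an σ p)
instP b ng an σ (and p q) = an (instP b ng an σ p) (instP b ng an σ q)

module TwoCH (n : ℕ) (APa : Fin n → Set) (APe : Set) where

  Agent : Set
  Agent = Fin n

  infixr 6 _∧A_ _∧E_ _∨A_ _∨E_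
  infix 7 ¬A_ ¬E_
  infixr 4 _⇒A_ _⇒E_

  mutual
    data AForm (a : Agent) : Set where
      atomA : APa a → AForm a
      ⊥A    : AForm a
      ¬A_   : AForm a → AForm a
      _∧A_  : AForm a → AForm a → AForm a
      ◇     : WForm → AForm a

    data WForm : Set where
      atomE : APe → WForm
      ⊥E    : WForm
      ¬E_   : WForm → WForm
      _∧E_  : WForm → WForm → WForm
      ⟨_⟩   : (a : Agent) → AForm a → WForm

  ⊤A : {a : Agent} → AForm a
  ⊤A = ¬A ⊥A
  ⊤E : WForm
  ⊤E = ¬E ⊥E

  _∨A_ : {a : Agent} → AForm a → AForm a → AForm a
  φ ∨A ψ = ¬A (¬A φ ∧A ¬A ψ)
  _⇒A_ : {a : Agent} → AForm a → AForm a → AForm a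
  φ ⇒A ψ = ¬A (φ ∧A ¬A ψ)
  _∨E_ : WForm → WForm → WForm
  Φ ∨E Ψ = ¬E (¬E Φ ∧E ¬E Ψ)
  _⇒E_ : WForm → WForm → WForm
  Φ ⇒E Ψ = ¬E (Φ ∧E ¬E Ψ)

  □ : {a : Agent} → WForm → AForm a
  □ Φ = ¬A (◇ (¬E Φ))

  [_] : (a : Agent) → AForm a → WForm
  [ a ] φ = ¬E (⟨ a ⟩ (¬A φ))

  ⋁⟨⟩⊤ : List Agent → WForm
  ⋁⟨⟩⊤ [] = ⊥E
  ⋁⟨⟩⊤ (a ∷ as) = ⟨ a ⟩ ⊤A ∨E ⋁⟨⟩⊤ as

  instA : {a : Agent} → (ℕ → AForm a) → Prop → AForm a
  instA = instP ⊥A ¬A_ _∧A_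

  instE : (ℕ → WForm) → Prop → WForm
  instE = instP ⊥E ¬E_ _∧E_

  mutual
    data ⊢A : (a : Agent) → AForm a → Set where
      tautA : ∀ {a} (p : Prop) (σ : ℕ → AForm a) → Tautology p → ⊢A a (instA σ p)
      mpA   : ∀ {a φ ψ} → ⊢A a (φ ⇒A ψ) → ⊢A a φ → ⊢A a ψ
      necA  : ∀ {a Φ} → ⊢E Φ → ⊢A a (□ Φ)
      mono◇ : ∀ {a Φ Ψ} → ⊢E (Φ ⇒E Ψ) → ⊢A a (◇ Φ ⇒A ◇ Ψ)
      mono□ : ∀ {a Φ Ψ} → ⊢E (Φ ⇒E Ψ) → ⊢A a (□ Φ ⇒A □ Ψ)
      adj1→ : ∀ {a Φ ψ} → ⊢E (Φ ⇒E [ a ] ψ) → ⊢A a (◇ Φ ⇒A ψ)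
      adj2← : ∀ {a φ Ψ} → ⊢E (⟨ a ⟩ φ ⇒E Ψ) → ⊢A a (φ ⇒A □ Ψ)
      unit  : ∀ {a φ} → ⊢A a (φ ⇒A ◇ (⟨ a ⟩ φ))
      counit : ∀ {a φ} → ⊢A a (◇ (⟨ a ⟩ φ) ⇒A φ)

    data ⊢E : WForm → Set where
      tautE : (p : Prop) (σ : ℕ → WForm) → Tautology p → ⊢E (instE σ p)
      mpE   : ∀ {Φ Ψ} → ⊢E (Φ ⇒E Ψ) → ⊢E Φ → ⊢E Ψ
      necE  : ∀ {a φ} → ⊢A a φ → ⊢E ([ a ] φ)
      mono⟨⟩ : ∀ {a φ ψ} → ⊢A a (φ ⇒A ψ) → ⊢E (⟨ a ⟩ φ ⇒E ⟨ a ⟩ ψ)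
      mono[] : ∀ {a φ ψ} → ⊢A a (φ ⇒A ψ) → ⊢E ([ a ] φ ⇒E [ a ] ψ)
      adj1← : ∀ {a Φ ψ} → ⊢A a (◇ Φ ⇒A ψ) → ⊢E (Φ ⇒E [ a ] ψ)
      adj2→ : ∀ {a φ Ψ} → ⊢A a (φ ⇒A □ Ψ) → ⊢E (⟨ a ⟩ φ ⇒E Ψ)
      someAgent : ⊢E (⋁⟨⟩⊤ (allFin n))

-- ⟨a⟩ is left adjoint to □_a and ◇_a is left adjoint to [a]; items (2)–(5) are units and
-- counits of these adjunctions.  (1) is the counit ◇_a⟨a⟩¬φ → ¬φ, contraposed and moved
-- across the first adjunction.  (6) is seriality: the unit at ⊤ gives ◇_a⟨a⟩⊤, while (4) at Φ
-- and at ¬Φ makes [a](◇_aΦ ∨ ◇_a¬Φ) derivable, so the second adjunction yields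
-- ◇_aΦ ∨ ◇_a¬Φ, i.e. □_aΦ → ◇_aΦ.  The propositional steps are tautology instances,
-- certified by truth tables.
module Submission where

open import Defs
open import Data.Bool using (Bool; true; false; T; not; _∧_)
open import Data.Bool.Properties using (T-∧; T-≡)
open import Data.Fin using (Fin)
open import Data.Nat using (ℕ; zero; suc; _<_; _⊔_; s≤s)
open import Data.Nat.Properties using (m<n⇒m<n⊔o; m<n⇒m<o⊔n; ≤-refl)
open import Data.Product using (_×_; _,_)
open import Function using (_∘_)
open import Function.Bundles using (Equivalence)
open import Relation.Binary.PropositionalEquality using (_≡_; refl; sym; trans; cong; cong₂)

_∷ᶠ_ : {A : Set} → A → (ℕ → A) → ℕ → A
(x ∷ᶠ f) zero    = x
(x ∷ᶠ f) (suc i) = f i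

infixr 5 _∷ᶠ_

varBound : Prop → ℕ
varBound (var k)   = suc k
varBound bot       = zero
varBound (neg p)   = varBound p
varBound (and p q) = varBound p ⊔ varBound q

evalP-cong : ∀ p {v w : ℕ → Bool} → (∀ i → i < varBound p → v i ≡ w i) →
             evalP v p ≡ evalP w p
evalP-cong (var k)   v≗w = v≗w k ≤-refl
evalP-cong bot       v≗w = refl
evalP-cong (neg p)   v≗w = cong not (evalP-cong p v≗w)
evalP-cong (and p q) v≗w =
  cong₂ _∧_ (evalP-cong p (λ i i<p → v≗w i (m<n⇒m<n⊔o (varBound q) i<p)))
            (evalP-cong q (λ i i<q → v≗w i (m<n⇒m<o⊔n (varBound p) i<q)))

restrict : ℕ → (ℕ → Bool) → ℕ → Bool
restrict zero    v = λ _ → false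
restrict (suc k) v = v 0 ∷ᶠ restrict k (v ∘ suc)

restrict-agrees : ∀ k v i → i < k → restrict k v i ≡ v i
restrict-agrees (suc k) v zero    _         = refl
restrict-agrees (suc k) v (suc i) (s≤s i<k) = restrict-agrees k (v ∘ suc) i i<k

allValuations : ℕ → ((ℕ → Bool) → Bool) → Bool
allValuations zero    f = f (λ _ → false)
allValuations (suc k) f = allValuations k (f ∘ (true ∷ᶠ_)) ∧ allValuations k (f ∘ (false ∷ᶠ_))

allValuations-sound : ∀ k f → T (allValuations k f) → ∀ v → T (f (restrict k v))
allValuations-sound zero    f h v = h
allValuations-sound (suc k) f h v with Equivalence.to T-∧ h | v 0
... | hᵗ , _ | true  = allValuations-sound k (f ∘ (true ∷ᶠ_)) hᵗ (v ∘ suc)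
... | _ , hᶠ | false = allValuations-sound k (f ∘ (false ∷ᶠ_)) hᶠ (v ∘ suc)

isTautology : Prop → Bool
isTautology p = allValuations (varBound p) (λ v → evalP v p)

isTautology-sound : ∀ p → T (isTautology p) → Tautology p
isTautology-sound p h v = trans
  (evalP-cong p (λ i i<k → sym (restrict-agrees (varBound p) v i i<k)))
  (Equivalence.to T-≡ (allValuations-sound (varBound p) (λ w → evalP w p) h v))

module Classical {F : Set} (⊥ : F) (¬_ : F → F) (_∧ᶠ_ : F → F → F) (⊢_ : F → Set)
  (taut : ∀ p σ → Tautology p → ⊢ instP ⊥ ¬_ _∧ᶠ_ σ p)
  (mp : ∀ {x y} → ⊢ ¬ (x ∧ᶠ (¬ y)) → ⊢ x → ⊢ y) where

  infixr 4 _⇒_ _⇒ₚ_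
  infixr 6 _∨_ _∨ₚ_

  _⇒_ : F → F → F
  x ⇒ y = ¬ (x ∧ᶠ (¬ y))

  _∨_ : F → F → F
  x ∨ y = ¬ ((¬ x) ∧ᶠ (¬ y))

  _⇒ₚ_ : Prop → Prop → Prop
  p ⇒ₚ q = neg (and p (neg q))

  _∨ₚ_ : Prop → Prop → Prop
  p ∨ₚ q = neg (and (neg p) (neg q))

  tautology : ∀ p σ → {T (isTautology p)} → ⊢ instP ⊥ ¬_ _∧ᶠ_ σ p
  tautology p σ {h} = taut p σ (isTautology-sound p h)

  formulas : F → F → F → ℕ → F
  formulas x y z = x ∷ᶠ y ∷ᶠ z ∷ᶠ λ _ → ⊥

  ⇒-refl : ∀ {x} → ⊢ (x ⇒ x)
  ⇒-refl {x} = tautology (var 0 ⇒ₚ var 0) (formulas x x x)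

  ⇒-trans : ∀ {x y z} → ⊢ (x ⇒ y) → ⊢ (y ⇒ z) → ⊢ (x ⇒ z)
  ⇒-trans {x} {y} {z} x⇒y y⇒z = mp (mp
    (tautology ((var 0 ⇒ₚ var 1) ⇒ₚ (var 1 ⇒ₚ var 2) ⇒ₚ var 0 ⇒ₚ var 2) (formulas x y z))
    x⇒y) y⇒z

  ⇒-const : ∀ {x} y → ⊢ x → ⊢ (y ⇒ x)
  ⇒-const {x} y ⊢x = mp (tautology (var 0 ⇒ₚ var 1 ⇒ₚ var 0) (formulas x y ⊥)) ⊢x

  ¬¬-elim : ∀ {x} → ⊢ (¬ ¬ x ⇒ x)
  ¬¬-elim {x} = tautology (neg (neg (var 0)) ⇒ₚ var 0) (formulas x ⊥ ⊥)

  ⇒¬-swap : ∀ {x y} → ⊢ (x ⇒ ¬ y) → ⊢ (y ⇒ ¬ x)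
  ⇒¬-swap {x} {y} =
    mp (tautology ((var 0 ⇒ₚ neg (var 1)) ⇒ₚ var 1 ⇒ₚ neg (var 0)) (formulas x y ⊥))

  by-cases : ∀ {x z} → ⊢ (x ⇒ z) → ⊢ (¬ x ⇒ z) → ⊢ z
  by-cases {x} {z} x⇒z ¬x⇒z = mp (mp
    (tautology ((var 0 ⇒ₚ var 1) ⇒ₚ (neg (var 0) ⇒ₚ var 1) ⇒ₚ var 1) (formulas x z ⊥))
    x⇒z) ¬x⇒z

  ⊤-intro : ⊢ ¬ ⊥
  ⊤-intro = tautology (neg bot) (formulas ⊥ ⊥ ⊥)

  ∨-introˡ : ∀ {x y} → ⊢ (x ⇒ x ∨ y)
  ∨-introˡ {x} {y} =
    tautology (var 0 ⇒ₚ var 0 ∨ₚ var 1) (formulas x y ⊥)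

  ∨-introʳ : ∀ {x y} → ⊢ (y ⇒ x ∨ y)
  ∨-introʳ {x} {y} =
    tautology (var 1 ⇒ₚ var 0 ∨ₚ var 1) (formulas x y ⊥)

  disjunctive-syllogism : ∀ {x y} → ⊢ (x ∨ y) → ⊢ (¬ y ⇒ x)
  disjunctive-syllogism {x} {y} = mp
    (tautology (var 0 ∨ₚ var 1 ⇒ₚ neg (var 1) ⇒ₚ var 0) (formulas x y ⊥))

module Modal (n : ℕ) (APa : Fin n → Set) (APe : Set) where
  open TwoCH n APa APe

  module A {a : Agent} = Classical ⊥A ¬A_ _∧A_ (⊢A a) tautA mpA
  module E = Classical ⊥E ¬E_ _∧E_ ⊢E tautE mpE

  module _ {a : Agent} where

    ⟨⟩⇒[] : ∀ {φ} → ⊢E (⟨ a ⟩ φ ⇒E [ a ] φ)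
    ⟨⟩⇒[] = adj2→ (A.⇒¬-swap (A.⇒-trans (mono◇ E.¬¬-elim) counit))

    ⟨⟩□⇒ : ∀ {Φ} → ⊢E (⟨ a ⟩ (□ Φ) ⇒E Φ)
    ⟨⟩□⇒ = adj2→ A.⇒-refl

    ⇒[]◇ : ∀ {Φ} → ⊢E (Φ ⇒E [ a ] (◇ Φ))
    ⇒[]◇ = adj1← A.⇒-refl

    ⇒□⟨⟩ : ∀ {φ} → ⊢A a (φ ⇒A □ (⟨ a ⟩ φ))
    ⇒□⟨⟩ = adj2← E.⇒-refl

    ◇⟨⟩⊤ : ⊢A a (◇ (⟨ a ⟩ ⊤A))
    ◇⟨⟩⊤ = mpA unit A.⊤-intro

    []◇-excluded-middle : ∀ {Φ} → ⊢E ([ a ] (◇ Φ ∨A ◇ (¬E Φ)))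
    []◇-excluded-middle = E.by-cases (E.⇒-trans ⇒[]◇ (mono[] A.∨-introˡ))
                                     (E.⇒-trans ⇒[]◇ (mono[] A.∨-introʳ))

    ◇-excluded-middle : ∀ {Φ} → ⊢A a (◇ Φ ∨A ◇ (¬E Φ))
    ◇-excluded-middle = mpA (adj1→ (E.⇒-const (⟨ a ⟩ ⊤A) []◇-excluded-middle)) ◇⟨⟩⊤

    □⇒◇ : ∀ {Φ} → ⊢A a (□ Φ ⇒A ◇ Φ)
    □⇒◇ = A.disjunctive-syllogism ◇-excluded-middle

mainTheorem6 : (n : ℕ) (APa : Fin n → Set) (APe : Set) →
    let open TwoCH n APa APe in
    (a : Agent) (φ : AForm a) (Φ : WForm) →
      ⊢E (⟨ a ⟩ φ ⇒E [ a ] φ)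
      × ⊢A a (□ Φ ⇒A □ (⟨ a ⟩ (□ Φ)))
      × ⊢E (⟨ a ⟩ (□ Φ) ⇒E Φ)
      × ⊢E (Φ ⇒E [ a ] (◇ Φ))
      × ⊢A a (φ ⇒A □ (⟨ a ⟩ φ))
      × ⊢A a (□ Φ ⇒A ◇ Φ)
mainTheorem6 n APa APe a φ Φ = ⟨⟩⇒[] , ⇒□⟨⟩ , ⟨⟩□⇒ , ⇒[]◇ , ⇒□⟨⟩ , □⇒◇
  where open Modal n APa APe
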